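{- The set $H=A^{m-1}$ is a linear subspace of $F^n$ and is an extended 1-perfect code.
   Context: Fix $m\ge 4$, $n=2^m$. $F^n$ is the set of binary words of length $n$ with Hamming distance and coordinatewise addition mod 2; $F^n_{Ev}$, $F^n_{Od}$ are the sets of even-weight and odd-weight words. For $\bar x\in F^n$, $\Omega(\bar x)=\{\bar y:d(\bar y,\bar x)=1\}$; $\Omega(S)=\bigcup_{\bar x\in S}\Omega(\bar x)$. An extended 1-perfect code is a set $C\subseteq F^n_{Ev}$ such that the sets $\Omega(\bar c)$, $\bar c\in C$, are pairwise disjoint and $\Omega(C)=F^n_{Od}$. For $t=1,\dots,m-1$, $V^t=\{(\bar v,\bar v,0,\dots,0)\in F^n:\bar v\in F^{2^{m-t}}_{Ev}\}$ ($\bar v$ in the first $2^{m-t}$ coordinates, a copy in the next $2^{m-t}$, zeros elsewhere); $A^1=V^1$ and $A^t=V^t+A^{t-1}=\{\bar r+\bar a:\bar r\in V^t,\bar a\in A^{t-1}\}$ for $t=2,\dots,m-1$. -}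

module Defs where

open import Data.Bool using (Bool; true; false; if_then_else_; _xor_)
open import Data.Nat using (ℕ; zero; suc; _+_; _*_; _∸_; _^_; _<ᵇ_)
open import Data.Fin using (Fin; toℕ)
open import Data.Vec using (Vec; []; _∷_; zipWith; replicate; tabulate)
open import Data.Product using (Σ; ∃; _×_; _,_)
open import Relation.Binary.PropositionalEquality using (_≡_)
open import Data.Empty using (⊥)
open import Relation.Nullary using (¬_)

Word : ℕ → Set
Word n = Vec Bool n

WordSet : ℕ → Set₁
WordSet n = Word n → Set

wt : ∀ {n} → Word n → ℕ
wt []           = 0
wt (true  ∷ xs) = suc (wt xs)
wt (false ∷ xs) = wt xs

IsEven : ℕ → Set
IsEven k = ∃ λ j → k ≡ 2 * j

IsOdd : ℕ → Set
IsOdd k = ∃ λ j → k ≡ suc (2 * j)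

EvenWord : ∀ {n} → WordSet n
EvenWord x = IsEven (wt x)

OddWord : ∀ {n} → WordSet n
OddWord x = IsOdd (wt x)

_⊕_ : ∀ {n} → Word n → Word n → Word n
_⊕_ = zipWith _xor_

zeroWord : ∀ {n} → Word n
zeroWord = replicate _ false

dist : ∀ {n} → Word n → Word n → ℕ
dist x y = wt (x ⊕ y)

InΩ : ∀ {n} → Word n → Word n → Set
InΩ x y = dist y x ≡ 1

IsExtPerfect : ∀ {n} → WordSet n → Set
IsExtPerfect {n} C =
    (∀ c → C c → EvenWord c)
  × (∀ c c' → C c → C c' → ¬ (c ≡ c') → ∀ y → InΩ c y → InΩ c' y → ⊥)
  × (∀ y → (Σ (Word n) λ c → C c × InΩ c y) → OddWord y)
  × (∀ y → OddWord y → Σ (Word n) λ c → C c × InΩ c y)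

IsLinear : ∀ {n} → WordSet n → Set
IsLinear {n} C = C zeroWord × (∀ x y → C x → C y → C (x ⊕ y))

-- coordinate j of a word (false if out of range)
at : ∀ {k} → Word k → ℕ → Bool
at []       _       = false
at (b ∷ _)  zero    = b
at (_ ∷ bs) (suc j) = at bs j

-- (v , v , 0, ..., 0) ∈ F^(2^m), v of length k placed in the first k
-- coordinates, a copy in the next k, zeros elsewhere
embed : (m k : ℕ) → Word k → Word (2 ^ m)
embed m k v = tabulate λ (i : Fin (2 ^ m)) →
  let j = toℕ i in
  if j <ᵇ k then at v j
  else if j <ᵇ (k + k) then at v (j ∸ k)
  else false

-- V^t  (for 1 ≤ t ≤ m-1)
V : (m t : ℕ) → WordSet (2 ^ m)
V m t x = Σ (Word (2 ^ (m ∸ t))) λ v → EvenWord v × x ≡ embed m (2 ^ (m ∸ t)) v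

_+ˢ_ : ∀ {n} → WordSet n → WordSet n → WordSet n
(S +ˢ T) x = Σ _ λ r → Σ _ λ a → S r × T a × x ≡ r ⊕ a

-- A'' m k = A^(k+1)
A′ : (m k : ℕ) → WordSet (2 ^ m)
A′ m zero    = V m 1
A′ m (suc k) = V m (suc (suc k)) +ˢ A′ m k

-- A^t for t ≥ 1
A : (m t : ℕ) → WordSet (2 ^ m)
A m t = A′ m (t ∸ 1)

H : (m : ℕ) → WordSet (2 ^ m)
H m = A m (m ∸ 1)

{-# OPTIONS --safe #-}
-- H is the iterated doubling C ↦ plotkin C = {(c ⊕ v) ∥ v : c ∈ C, v even}
-- of the zero code of length 2: V^1 = plotkin {0}, and for t ≥ 2 the words of
-- V^t in length 2^m are those of V^(t-1) in length 2^(m-1) padded by zeros, so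
-- A^t in length 2^m is the doubling of A^(t-1) in length 2^(m-1).
-- Doubling preserves linearity, and it preserves extended perfectness: folding
-- (e ∥ f) ↦ e ⊕ f sends a codeword neighbour (c ⊕ v) ∥ v of e ∥ f to the
-- neighbour c of e ⊕ f in C, which is unique, while the parity of f tells in
-- which half the two words differ and thereby determines v.
module Submission where

open import Defs
open import Data.Bool using (Bool; true; false; _xor_; if_then_else_)
open import Data.Bool.Properties
  using (_≟_; xor-assoc; xor-comm; xor-identityˡ; xor-identityʳ; xor-same; T-≡)
open import Data.Fin using (toℕ)
open import Data.Fin.Properties using (toℕ<n)
open import Data.Nat using (ℕ; zero; suc; _+_; _*_; _∸_; _^_; _<ᵇ_; _≤_; _<_; s≤s; parity)
open import Data.Nat.Properties
  using (+-identityʳ; +-suc; suc-injective; ≤-trans; m≤m+n; +-mono-≤; +-monoʳ-<;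
         m+n∸m≡n; m∸n≤m; ^-monoʳ-≤; <⇒<ᵇ; even≢odd)
open import Data.Parity.Base as ℙ using (Parity; 0ℙ; 1ℙ; _⁻¹)
import Data.Parity.Properties as ℙₚ
open import Algebra.Properties.CommutativeSemigroup ℙₚ.+-commutativeSemigroup
  using () renaming (interchange to ℙ-interchange)
open import Data.Product using (Σ-syntax; ∃₂; _×_; _,_; proj₁; proj₂)
open import Data.Sum using (_⊎_; inj₁; inj₂) renaming (map to ⊎-map)
open import Data.Vec using (Vec; []; _∷_; _++_; tabulate; splitAt)
open import Data.Vec.Properties
  using (zipWith-assoc; zipWith-comm; zipWith-identityˡ; zipWith-identityʳ; zipWith-++;
         tabulate-cong; ≡-dec)
open import Function using (_∘_)
open import Function.Bundles using (Equivalence)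
open import Relation.Binary.PropositionalEquality
  using (_≡_; refl; sym; trans; cong; cong₂; subst; module ≡-Reasoning)
open import Relation.Nullary using (¬_; contradiction)
open import Relation.Nullary.Decidable using (decidable-stable)
open import Relation.Unary using (_⊆_; _≐_; ｛_｝)
open import Relation.Unary.Properties using (≐-sym; ≐-trans)

open ≡-Reasoning

private
  variable
    X : Set
    m n : ℕ
    C P Q P′ Q′ : WordSet n

⊕-assoc : (x y z : Word n) → (x ⊕ y) ⊕ z ≡ x ⊕ (y ⊕ z)
⊕-assoc = zipWith-assoc xor-assoc

⊕-comm : (x y : Word n) → x ⊕ y ≡ y ⊕ x
⊕-comm = zipWith-comm xor-comm

⊕-identityˡ : (x : Word n) → zeroWord ⊕ x ≡ x
⊕-identityˡ = zipWith-identityˡ xor-identityˡ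

⊕-identityʳ : (x : Word n) → x ⊕ zeroWord ≡ x
⊕-identityʳ = zipWith-identityʳ xor-identityʳ

⊕-self : (x : Word n) → x ⊕ x ≡ zeroWord
⊕-self []      = refl
⊕-self (b ∷ x) = cong₂ _∷_ (xor-same b) (⊕-self x)

⊕-interchange : (a b c d : Word n) → (a ⊕ b) ⊕ (c ⊕ d) ≡ (a ⊕ c) ⊕ (b ⊕ d)
⊕-interchange a b c d = begin
  (a ⊕ b) ⊕ (c ⊕ d)   ≡⟨ ⊕-assoc a b (c ⊕ d) ⟩
  a ⊕ (b ⊕ (c ⊕ d))   ≡⟨ cong (a ⊕_) (⊕-assoc b c d) ⟨
  a ⊕ ((b ⊕ c) ⊕ d)   ≡⟨ cong (λ t → a ⊕ (t ⊕ d)) (⊕-comm b c) ⟩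
  a ⊕ ((c ⊕ b) ⊕ d)   ≡⟨ cong (a ⊕_) (⊕-assoc c b d) ⟩
  a ⊕ (c ⊕ (b ⊕ d))   ≡⟨ ⊕-assoc a c (b ⊕ d) ⟨
  (a ⊕ c) ⊕ (b ⊕ d)   ∎

[x⊕y]⊕y≡x : (x y : Word n) → (x ⊕ y) ⊕ y ≡ x
[x⊕y]⊕y≡x x y = begin
  (x ⊕ y) ⊕ y     ≡⟨ ⊕-assoc x y y ⟩
  x ⊕ (y ⊕ y)     ≡⟨ cong (x ⊕_) (⊕-self y) ⟩
  x ⊕ zeroWord    ≡⟨ ⊕-identityʳ x ⟩
  x               ∎

x⊕[x⊕y]≡y : (x y : Word n) → x ⊕ (x ⊕ y) ≡ y
x⊕[x⊕y]≡y x y = begin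
  x ⊕ (x ⊕ y)     ≡⟨ ⊕-assoc x x y ⟨
  (x ⊕ x) ⊕ y     ≡⟨ cong (_⊕ y) (⊕-self x) ⟩
  zeroWord ⊕ y    ≡⟨ ⊕-identityˡ y ⟩
  y               ∎

⊕-cancelˡ-≡ : (x : Word n) {y z : Word n} → x ⊕ y ≡ x ⊕ z → y ≡ z
⊕-cancelˡ-≡ x {y} {z} eq = begin
  y               ≡⟨ x⊕[x⊕y]≡y x y ⟨
  x ⊕ (x ⊕ y)     ≡⟨ cong (x ⊕_) eq ⟩
  x ⊕ (x ⊕ z)     ≡⟨ x⊕[x⊕y]≡y x z ⟩
  z               ∎

wt-zeroWord : wt (zeroWord {n}) ≡ 0
wt-zeroWord {zero}  = refl
wt-zeroWord {suc n} = wt-zeroWord {n}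

wt-++ : (x : Word m) (y : Word n) → wt (x ++ y) ≡ wt x + wt y
wt-++ []          y = refl
wt-++ (true ∷ x)  y = cong suc (wt-++ x y)
wt-++ (false ∷ x) y = wt-++ x y

dist-self : (x : Word n) → dist x x ≡ 0
dist-self {n} x = trans (cong wt (⊕-self x)) (wt-zeroWord {n})

dist≡0⇒≡ : (x y : Word n) → dist x y ≡ 0 → x ≡ y
dist≡0⇒≡ []          []          _  = refl
dist≡0⇒≡ (true ∷ x)  (true ∷ y)  eq = cong (true ∷_) (dist≡0⇒≡ x y eq)
dist≡0⇒≡ (false ∷ x) (false ∷ y) eq = cong (false ∷_) (dist≡0⇒≡ x y eq)
dist≡0⇒≡ (true ∷ x)  (false ∷ y) ()
dist≡0⇒≡ (false ∷ x) (true ∷ y)  ()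

dist-⊕ˡ : (a b d : Word n) → dist (a ⊕ b) (a ⊕ d) ≡ dist b d
dist-⊕ˡ a b d = cong wt (begin
  (a ⊕ b) ⊕ (a ⊕ d)          ≡⟨ ⊕-interchange a b a d ⟩
  (a ⊕ a) ⊕ (b ⊕ d)          ≡⟨ cong (_⊕ (b ⊕ d)) (⊕-self a) ⟩
  zeroWord ⊕ (b ⊕ d)         ≡⟨ ⊕-identityˡ (b ⊕ d) ⟩
  b ⊕ d                      ∎)

dist-⊕ʳ : (a b c : Word n) → dist (a ⊕ b) (c ⊕ b) ≡ dist a c
dist-⊕ʳ a b c = cong wt (begin
  (a ⊕ b) ⊕ (c ⊕ b)          ≡⟨ ⊕-interchange a b c b ⟩
  (a ⊕ c) ⊕ (b ⊕ b)          ≡⟨ cong ((a ⊕ c) ⊕_) (⊕-self b) ⟩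
  (a ⊕ c) ⊕ zeroWord         ≡⟨ ⊕-identityʳ (a ⊕ c) ⟩
  a ⊕ c                      ∎)

even⇒parity≡0ℙ : ∀ {k} → IsEven k → parity k ≡ 0ℙ
even⇒parity≡0ℙ (j , refl) = ℙₚ.*-homo-* 2 j

odd⇒parity≡1ℙ : ∀ {k} → IsOdd k → parity k ≡ 1ℙ
odd⇒parity≡1ℙ (j , refl) = trans (ℙₚ.+-homo-+ 1 (2 * j)) (cong _⁻¹ (ℙₚ.*-homo-* 2 j))

even-or-odd : ∀ k → IsEven k ⊎ IsOdd k
even-or-odd zero = inj₁ (0 , refl)
even-or-odd (suc k) with even-or-odd k
... | inj₁ (j , refl) = inj₂ (j , refl)
... | inj₂ (j , refl) = inj₁ (suc j , cong suc (sym (+-suc j (j + 0))))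

even⇒¬odd : ∀ {k} → IsEven k → ¬ IsOdd k
even⇒¬odd (i , refl) (j , eq) = even≢odd i j eq

parity≡0ℙ⇒even : ∀ {k} → parity k ≡ 0ℙ → IsEven k
parity≡0ℙ⇒even {k} eq with even-or-odd k
... | inj₁ even = even
... | inj₂ odd  = contradiction (trans (sym eq) (odd⇒parity≡1ℙ odd)) λ ()

parity≡1ℙ⇒odd : ∀ {k} → parity k ≡ 1ℙ → IsOdd k
parity≡1ℙ⇒odd {k} eq with even-or-odd k
... | inj₁ even = contradiction (trans (sym eq) (even⇒parity≡0ℙ even)) λ ()
... | inj₂ odd  = odd

bitParity : Bool → Parity
bitParity false = 0ℙ
bitParity true  = 1ℙ

bitParity-xor : ∀ a b → bitParity (a xor b) ≡ bitParity a ℙ.+ bitParity b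
bitParity-xor false b     = refl
bitParity-xor true  false = refl
bitParity-xor true  true  = refl

parity-wt-∷ : ∀ b (x : Word n) → parity (wt (b ∷ x)) ≡ bitParity b ℙ.+ parity (wt x)
parity-wt-∷ false x = refl
parity-wt-∷ true  x = ℙₚ.+-homo-+ 1 (wt x)

parity-wt-⊕ : (x y : Word n) → parity (wt (x ⊕ y)) ≡ parity (wt x) ℙ.+ parity (wt y)
parity-wt-⊕ []      []      = refl
parity-wt-⊕ (a ∷ x) (b ∷ y) = begin
  parity (wt ((a xor b) ∷ (x ⊕ y)))
    ≡⟨ parity-wt-∷ (a xor b) (x ⊕ y) ⟩
  bitParity (a xor b) ℙ.+ parity (wt (x ⊕ y))
    ≡⟨ cong₂ ℙ._+_ (bitParity-xor a b) (parity-wt-⊕ x y) ⟩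
  (bitParity a ℙ.+ bitParity b) ℙ.+ (parity (wt x) ℙ.+ parity (wt y))
    ≡⟨ ℙ-interchange (bitParity a) (bitParity b) (parity (wt x)) (parity (wt y)) ⟩
  (bitParity a ℙ.+ parity (wt x)) ℙ.+ (bitParity b ℙ.+ parity (wt y))
    ≡⟨ cong₂ ℙ._+_ (parity-wt-∷ a x) (parity-wt-∷ b y) ⟨
  parity (wt (a ∷ x)) ℙ.+ parity (wt (b ∷ y))
    ∎

even-⊕ : (x y : Word n) → EvenWord x → EvenWord y → EvenWord (x ⊕ y)
even-⊕ x y x-even y-even = parity≡0ℙ⇒even (begin
  parity (wt (x ⊕ y))               ≡⟨ parity-wt-⊕ x y ⟩
  parity (wt x) ℙ.+ parity (wt y)   ≡⟨ cong₂ ℙ._+_ (even⇒parity≡0ℙ x-even) (even⇒parity≡0ℙ y-even) ⟩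
  0ℙ                                ∎)

even-neighbour-odd : (c y : Word n) → EvenWord c → InΩ c y → OddWord y
even-neighbour-odd c y c-even d = parity≡1ℙ⇒odd (begin
  parity (wt y)                     ≡⟨ ℙₚ.+-identityʳ _ ⟨
  parity (wt y) ℙ.+ 0ℙ              ≡⟨ cong (parity (wt y) ℙ.+_) (even⇒parity≡0ℙ c-even) ⟨
  parity (wt y) ℙ.+ parity (wt c)   ≡⟨ parity-wt-⊕ y c ⟨
  parity (wt (y ⊕ c))               ≡⟨ cong parity d ⟩
  1ℙ                                ∎)

-- Words of length 2n as pairs of halves

_∥_ : Word n → Word n → Word (2 * n)
a ∥ b = a ++ (b ++ [])

∥-split : (y : Word (2 * n)) → ∃₂ λ a b → y ≡ a ∥ b
∥-split {n} y with splitAt n y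
... | a , rest , refl with splitAt n rest
... | b , [] , refl = a , b , refl

∥-⊕ : (a b c d : Word n) → (a ∥ b) ⊕ (c ∥ d) ≡ (a ⊕ c) ∥ (b ⊕ d)
∥-⊕ a b c d = trans (zipWith-++ _xor_ a (b ++ []) c (d ++ []))
                    (cong ((a ⊕ c) ++_) (zipWith-++ _xor_ b [] d []))

zeroWord-∥ : zeroWord ≡ zeroWord {n} ∥ zeroWord
zeroWord-∥ {n} = begin
  zeroWord                ≡⟨ ⊕-self (o ∥ o) ⟨
  (o ∥ o) ⊕ (o ∥ o)       ≡⟨ ∥-⊕ o o o o ⟩
  (o ⊕ o) ∥ (o ⊕ o)       ≡⟨ cong₂ _∥_ (⊕-self o) (⊕-self o) ⟩
  o ∥ o                   ∎
  where
  o = zeroWord {n}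

wt-∥ : (a b : Word n) → wt (a ∥ b) ≡ wt a + wt b
wt-∥ a b = trans (wt-++ a (b ++ [])) (cong (wt a +_) (trans (wt-++ b []) (+-identityʳ (wt b))))

dist-∥ : (a b c d : Word n) → dist (a ∥ b) (c ∥ d) ≡ dist a c + dist b d
dist-∥ a b c d = trans (cong wt (∥-⊕ a b c d)) (wt-∥ (a ⊕ c) (b ⊕ d))

parity-wt-∥ : (a b : Word n) → parity (wt (a ∥ b)) ≡ parity (wt a) ℙ.+ parity (wt b)
parity-wt-∥ a b = trans (cong parity (wt-∥ a b)) (ℙₚ.+-homo-+ (wt a) (wt b))

even-∥ : (a b : Word n) → EvenWord a → EvenWord b → EvenWord (a ∥ b)
even-∥ a b a-even b-even = parity≡0ℙ⇒even (begin
  parity (wt (a ∥ b))               ≡⟨ parity-wt-∥ a b ⟩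
  parity (wt a) ℙ.+ parity (wt b)   ≡⟨ cong₂ ℙ._+_ (even⇒parity≡0ℙ a-even) (even⇒parity≡0ℙ b-even) ⟩
  0ℙ                                ∎)

odd-∥⇒odd-⊕ : (a b : Word n) → OddWord (a ∥ b) → OddWord (a ⊕ b)
odd-∥⇒odd-⊕ a b odd = parity≡1ℙ⇒odd (begin
  parity (wt (a ⊕ b))               ≡⟨ parity-wt-⊕ a b ⟩
  parity (wt a) ℙ.+ parity (wt b)   ≡⟨ parity-wt-∥ a b ⟨
  parity (wt (a ∥ b))               ≡⟨ odd⇒parity≡1ℙ odd ⟩
  1ℙ                                ∎)

odd-∥-oddˡ⇒evenʳ : (a b : Word n) → OddWord (a ∥ b) → OddWord a → EvenWord b
odd-∥-oddˡ⇒evenʳ a b odd a-odd = parity≡0ℙ⇒even (ℙₚ.⁻¹-injective (begin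
  parity (wt b) ⁻¹                  ≡⟨⟩
  1ℙ ℙ.+ parity (wt b)              ≡⟨ cong (ℙ._+ parity (wt b)) (odd⇒parity≡1ℙ a-odd) ⟨
  parity (wt a) ℙ.+ parity (wt b)   ≡⟨ parity-wt-∥ a b ⟨
  parity (wt (a ∥ b))               ≡⟨ odd⇒parity≡1ℙ odd ⟩
  1ℙ                                ∎))

m+n≡1-cases : ∀ m {n} → m + n ≡ 1 → (m ≡ 0 × n ≡ 1) ⊎ (m ≡ 1 × n ≡ 0)
m+n≡1-cases zero          eq = inj₁ (refl , eq)
m+n≡1-cases (suc zero)    eq = inj₂ (refl , suc-injective eq)
m+n≡1-cases (suc (suc m)) ()

dist-∥≡1 : (a b c d : Word n) → dist (a ∥ b) (c ∥ d) ≡ 1 →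
           (a ≡ c × dist b d ≡ 1) ⊎ (dist a c ≡ 1 × b ≡ d)
dist-∥≡1 a b c d eq with m+n≡1-cases (dist a c) (trans (sym (dist-∥ a b c d)) eq)
... | inj₁ (ac≡0 , bd≡1) = inj₁ (dist≡0⇒≡ a c ac≡0 , bd≡1)
... | inj₂ (ac≡1 , bd≡0) = inj₂ (ac≡1 , dist≡0⇒≡ b d bd≡0)

dist-∥-fold : ∀ {a b c d : Word n} → a ≡ c ⊎ b ≡ d → dist (a ∥ b) (c ∥ d) ≡ dist (a ⊕ b) (c ⊕ d)
dist-∥-fold {a = a} {b = b} {d = d} (inj₁ refl) = begin
  dist (a ∥ b) (a ∥ d)        ≡⟨ dist-∥ a b a d ⟩
  dist a a + dist b d         ≡⟨ cong (_+ dist b d) (dist-self a) ⟩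
  dist b d                    ≡⟨ dist-⊕ˡ a b d ⟨
  dist (a ⊕ b) (a ⊕ d)        ∎
dist-∥-fold {a = a} {b = b} {c = c} (inj₂ refl) = begin
  dist (a ∥ b) (c ∥ b)        ≡⟨ dist-∥ a b c b ⟩
  dist a c + dist b b         ≡⟨ cong (dist a c +_) (dist-self b) ⟩
  dist a c + 0                ≡⟨ +-identityʳ (dist a c) ⟩
  dist a c                    ≡⟨ dist-⊕ʳ a b c ⟨
  dist (a ⊕ b) (c ⊕ b)        ∎

fold-neighbour : (a b e f : Word n) → InΩ (a ∥ b) (e ∥ f) → InΩ (a ⊕ b) (e ⊕ f)
fold-neighbour a b e f d =
  trans (sym (dist-∥-fold (⊎-map proj₁ proj₂ (dist-∥≡1 e f a b d)))) d

unfold-neighbour : (a b e f : Word n) → e ≡ a ⊎ f ≡ b → InΩ (a ⊕ b) (e ⊕ f) → InΩ (a ∥ b) (e ∥ f)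
unfold-neighbour a b e f agree d = trans (dist-∥-fold agree) d

Ω : WordSet n → WordSet n
Ω C y = Σ[ c ∈ Word _ ] C c × InΩ c y

NeighbourUnique : WordSet n → Set
NeighbourUnique C = ∀ {c c′} y → C c → C c′ → InΩ c y → InΩ c′ y → c ≡ c′

mkIsExtPerfect : C ⊆ EvenWord →
                 NeighbourUnique C →
                 (∀ y → OddWord y → Ω C y) →
                 IsExtPerfect C
mkIsExtPerfect even unique cover =
  (λ _ → even) ,
  (λ c c′ Cc Cc′ c≢c′ y d d′ → c≢c′ (unique y Cc Cc′ d d′)) ,
  (λ y (c , Cc , d) → even-neighbour-odd c y (even Cc) d) ,
  cover

neighbour-unique : IsExtPerfect C → NeighbourUnique C
neighbour-unique (_ , disjoint , _) {c} {c′} y Cc Cc′ d d′ =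
  decidable-stable (≡-dec _≟_ c c′) (λ c≢c′ → disjoint c c′ Cc Cc′ c≢c′ y d d′)

IsLinear-resp-≐ : P ≐ Q → IsLinear P → IsLinear Q
IsLinear-resp-≐ (P⊆Q , Q⊆P) (P0 , P⊕) =
  P⊆Q P0 , λ x y Qx Qy → P⊆Q (P⊕ x y (Q⊆P Qx) (Q⊆P Qy))

IsExtPerfect-resp-≐ : P ≐ Q → IsExtPerfect P → IsExtPerfect Q
IsExtPerfect-resp-≐ (P⊆Q , Q⊆P) P-perfect@(P-even , _ , _ , P-cover) =
  mkIsExtPerfect (λ Qc → P-even _ (Q⊆P Qc))
                 (λ y Qc Qc′ → neighbour-unique P-perfect y (Q⊆P Qc) (Q⊆P Qc′))
                 (λ y odd → let c , Pc , d = P-cover y odd in c , P⊆Q Pc , d)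

｛0｝-isLinear : IsLinear ｛ zeroWord {n} ｝
｛0｝-isLinear = refl , λ { _ _ refl refl → sym (⊕-self zeroWord) }

｛0｝-isExtPerfect : IsExtPerfect ｛ zeroWord {2} ｝
｛0｝-isExtPerfect =
  mkIsExtPerfect {C = ｛ zeroWord ｝} (λ { refl → 0 , refl }) (λ { _ refl refl _ _ → refl }) cover
  where
  cover : ∀ y → OddWord y → Ω ｛ zeroWord ｝ y
  cover (true ∷ false ∷ [])  _   = zeroWord , refl , refl
  cover (false ∷ true ∷ [])  _   = zeroWord , refl , refl
  cover (false ∷ false ∷ []) (_ , ())
  cover (true ∷ true ∷ [])   odd = contradiction (odd⇒parity≡1ℙ odd) λ ()

-- The doubling construction

-- Plotkin's (u ∥ u ⊕ w) construction with u ranging over the even-weight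
-- words and w over C, with the two halves swapped.
plotkin : WordSet n → WordSet (2 * n)
plotkin C x = Σ[ p ∈ Word _ ] Σ[ v ∈ Word _ ] C p × EvenWord v × x ≡ (p ⊕ v) ∥ v

plotkin-isLinear : IsLinear P → IsLinear (plotkin P)
plotkin-isLinear {n} (P0 , P⊕) = zero∈ , sum∈
  where
  zero∈ : plotkin _ zeroWord
  zero∈ = zeroWord , zeroWord , P0 , (0 , wt-zeroWord {n}) ,
          trans (zeroWord-∥ {n}) (cong (_∥ zeroWord) (sym (⊕-self (zeroWord {n}))))
  sum∈ : ∀ x y → plotkin _ x → plotkin _ y → plotkin _ (x ⊕ y)
  sum∈ _ _ (p , v , Pp , v-even , refl) (q , w , Pq , w-even , refl) =
    p ⊕ q , v ⊕ w , P⊕ p q Pp Pq , even-⊕ v w v-even w-even ,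
    trans (∥-⊕ (p ⊕ v) v (q ⊕ w) w) (cong (_∥ (v ⊕ w)) (⊕-interchange p v q w))

plotkin-neighbour-fold : (p v e f : Word n) → InΩ ((p ⊕ v) ∥ v) (e ∥ f) → InΩ p (e ⊕ f)
plotkin-neighbour-fold p v e f d =
  subst (λ q → InΩ q (e ⊕ f)) ([x⊕y]⊕y≡x p v) (fold-neighbour (p ⊕ v) v e f d)

plotkin-neighbour-unfold : (p v e f : Word n) → e ≡ p ⊕ v ⊎ f ≡ v →
                           InΩ p (e ⊕ f) → InΩ ((p ⊕ v) ∥ v) (e ∥ f)
plotkin-neighbour-unfold p v e f agree d =
  unfold-neighbour (p ⊕ v) v e f agree
    (subst (λ q → InΩ q (e ⊕ f)) (sym ([x⊕y]⊕y≡x p v)) d)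

plotkin-neighbour-half : (p v e f : Word n) → EvenWord v → InΩ ((p ⊕ v) ∥ v) (e ∥ f) →
                         (OddWord f × e ≡ p ⊕ v) ⊎ (EvenWord f × f ≡ v)
plotkin-neighbour-half p v e f v-even d
  with dist-∥≡1 e f (p ⊕ v) v d
... | inj₁ (e≡p⊕v , d₂) = inj₁ (even-neighbour-odd v f v-even d₂ , e≡p⊕v)
... | inj₂ (_ , refl)    = inj₂ (v-even , refl)

plotkin-second-half-unique : (p v v′ : Word n) (y : Word (2 * n)) →
                             EvenWord v → EvenWord v′ →
                             InΩ ((p ⊕ v) ∥ v) y → InΩ ((p ⊕ v′) ∥ v′) y → v ≡ v′
plotkin-second-half-unique {n} p v v′ y v-even v′-even d d′ with ∥-split {n} y
... | e , f , refl =
  agree (plotkin-neighbour-half p v e f v-even d) (plotkin-neighbour-half p v′ e f v′-even d′)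
  where
  agree : (OddWord f × e ≡ p ⊕ v) ⊎ (EvenWord f × f ≡ v) →
          (OddWord f × e ≡ p ⊕ v′) ⊎ (EvenWord f × f ≡ v′) → v ≡ v′
  agree (inj₁ (_ , e≡p⊕v))  (inj₁ (_ , e≡p⊕v′)) = ⊕-cancelˡ-≡ p (trans (sym e≡p⊕v) e≡p⊕v′)
  agree (inj₂ (_ , f≡v))    (inj₂ (_ , f≡v′))   = trans (sym f≡v) f≡v′
  agree (inj₁ (f-odd , _))  (inj₂ (f-even , _)) = contradiction f-odd (even⇒¬odd f-even)
  agree (inj₂ (f-even , _)) (inj₁ (f-odd , _))  = contradiction f-odd (even⇒¬odd f-even)

plotkin-unique : NeighbourUnique P → NeighbourUnique (plotkin P)
plotkin-unique {n} P-unique y (p , v , Pp , v-even , refl) (p′ , v′ , Pp′ , v′-even , refl) d d′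
  with ∥-split {n} y
... | e , f , refl
  with refl ← P-unique (e ⊕ f) Pp Pp′ (plotkin-neighbour-fold p v e f d)
                                      (plotkin-neighbour-fold p′ v′ e f d′)
  = cong (λ w → (p ⊕ w) ∥ w) (plotkin-second-half-unique p v v′ (e ∥ f) v-even v′-even d d′)

plotkin-cover : P ⊆ EvenWord → (∀ y → OddWord y → Ω P y) → ∀ y → OddWord y → Ω (plotkin P) y
plotkin-cover {n} P-even P-cover y y-odd with ∥-split {n} y
... | e , f , refl with P-cover (e ⊕ f) (odd-∥⇒odd-⊕ e f y-odd) | even-or-odd (wt e)
... | p , Pp , d | inj₁ e-even =
  (p ⊕ (p ⊕ e)) ∥ (p ⊕ e) , (p , p ⊕ e , Pp , even-⊕ p e (P-even Pp) e-even , refl) ,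
  plotkin-neighbour-unfold p (p ⊕ e) e f (inj₁ (sym (x⊕[x⊕y]≡y p e))) d
... | p , Pp , d | inj₂ e-odd =
  (p ⊕ f) ∥ f , (p , f , Pp , odd-∥-oddˡ⇒evenʳ e f y-odd e-odd , refl) ,
  plotkin-neighbour-unfold p f e f (inj₂ refl) d

plotkin-isExtPerfect : IsExtPerfect P → IsExtPerfect (plotkin P)
plotkin-isExtPerfect P-perfect@(P-even , _ , _ , P-cover) =
  mkIsExtPerfect even (plotkin-unique (neighbour-unique P-perfect))
                 (plotkin-cover (P-even _) P-cover)
  where
  even : plotkin _ ⊆ EvenWord
  even (p , v , Pp , v-even , refl) = even-∥ (p ⊕ v) v (even-⊕ p v (P-even p Pp) v-even) v-even

-- The sets V^t and A^t

padZero : WordSet n → WordSet (2 * n)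
padZero C x = Σ[ z ∈ Word _ ] C z × x ≡ z ∥ zeroWord

+ˢ-resp-≐ : P ≐ P′ → Q ≐ Q′ → (P +ˢ Q) ≐ (P′ +ˢ Q′)
+ˢ-resp-≐ (P⊆P′ , P′⊆P) (Q⊆Q′ , Q′⊆Q) =
  (λ (r , a , Pr , Qa , eq) → r , a , P⊆P′ Pr , Q⊆Q′ Qa , eq) ,
  (λ (r , a , Pr , Qa , eq) → r , a , P′⊆P Pr , Q′⊆Q Qa , eq)

+ˢ-identityʳ : (Q +ˢ ｛ zeroWord ｝) ≐ Q
+ˢ-identityʳ {Q = Q} =
  (λ { (r , _ , Qr , refl , refl) → subst Q (sym (⊕-identityʳ r)) Qr }) ,
  (λ {x} Qx → x , zeroWord , Qx , refl , sym (⊕-identityʳ x))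

plotkin-resp-≐ : P ≐ Q → plotkin P ≐ plotkin Q
plotkin-resp-≐ (P⊆Q , Q⊆P) =
  (λ (p , v , Pp , v-even , eq) → p , v , P⊆Q Pp , v-even , eq) ,
  (λ (p , v , Qp , v-even , eq) → p , v , Q⊆P Qp , v-even , eq)

padZero-+ˢ-plotkin : (padZero Q +ˢ plotkin P) ≐ plotkin (Q +ˢ P)
padZero-+ˢ-plotkin =
  (λ { (_ , _ , (z , Qz , refl) , (p , v , Pp , v-even , refl) , refl) →
         z ⊕ p , v , (z , p , Qz , Pp , refl) , v-even , shift z p v }) ,
  (λ { (_ , v , (z , p , Qz , Pp , refl) , v-even , refl) →
         z ∥ zeroWord , (p ⊕ v) ∥ v , (z , Qz , refl) , (p , v , Pp , v-even , refl) ,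
         sym (shift z p v) })
  where
  shift : (z p v : Word n) → (z ∥ zeroWord) ⊕ ((p ⊕ v) ∥ v) ≡ ((z ⊕ p) ⊕ v) ∥ v
  shift z p v = begin
    (z ∥ zeroWord) ⊕ ((p ⊕ v) ∥ v)    ≡⟨ ∥-⊕ z zeroWord (p ⊕ v) v ⟩
    (z ⊕ (p ⊕ v)) ∥ (zeroWord ⊕ v)    ≡⟨ cong₂ _∥_ (sym (⊕-assoc z p v)) (⊕-identityˡ v) ⟩
    ((z ⊕ p) ⊕ v) ∥ v                 ∎

tabulateℕ : (n : ℕ) → (ℕ → X) → Vec X n
tabulateℕ n g = tabulate (g ∘ toℕ)

tabulateℕ-++ : ∀ m {n} (g : ℕ → X) →
               tabulateℕ (m + n) g ≡ tabulateℕ m g ++ tabulateℕ n (g ∘ (m +_))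
tabulateℕ-++ zero    g = refl
tabulateℕ-++ (suc m) g = cong (g 0 ∷_) (tabulateℕ-++ m (g ∘ suc))

tabulateℕ-∥ : ∀ n (g : ℕ → Bool) → tabulateℕ (2 * n) g ≡ tabulateℕ n g ∥ tabulateℕ n (g ∘ (n +_))
tabulateℕ-∥ n g = trans (tabulateℕ-++ n g) (cong (tabulateℕ n g ++_) (tabulateℕ-++ n (g ∘ (n +_))))

tabulateℕ-cong : {g h : ℕ → X} → (∀ {j} → j < n → g j ≡ h j) → tabulateℕ n g ≡ tabulateℕ n h
tabulateℕ-cong eq = tabulate-cong (λ i → eq (toℕ<n i))

tabulateℕ-at : (v : Word n) → tabulateℕ n (at v) ≡ v
tabulateℕ-at []      = refl
tabulateℕ-at (b ∷ v) = cong (b ∷_) (tabulateℕ-at v)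

tabulateℕ-false : tabulateℕ n (λ _ → false) ≡ zeroWord
tabulateℕ-false {zero}  = refl
tabulateℕ-false {suc n} = cong (false ∷_) (tabulateℕ-false {n})

<ᵇ-true : ∀ {j k} → j < k → (j <ᵇ k) ≡ true
<ᵇ-true j<k = Equivalence.to T-≡ (<⇒<ᵇ j<k)

<ᵇ-false : ∀ {j k} → k ≤ j → (j <ᵇ k) ≡ false
<ᵇ-false {k = zero}  _         = refl
<ᵇ-false {k = suc k} (s≤s k≤j) = <ᵇ-false k≤j

-- The entry function of embed, so that embed m k v is definitionally
-- tabulateℕ (2 ^ m) (embedBit k v).
embedBit : (k : ℕ) → Word k → ℕ → Bool
embedBit k v j = if j <ᵇ k then at v j else if j <ᵇ (k + k) then at v (j ∸ k) else false

embed-half : ∀ m (v : Word (2 ^ m)) → embed (suc m) (2 ^ m) v ≡ v ∥ v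
embed-half m v = begin
  embed (suc m) N v
    ≡⟨ tabulateℕ-∥ N (embedBit N v) ⟩
  tabulateℕ N (embedBit N v) ∥ tabulateℕ N (embedBit N v ∘ (N +_))
    ≡⟨ cong₂ _∥_ (tabulateℕ-cong first) (tabulateℕ-cong second) ⟩
  tabulateℕ N (at v) ∥ tabulateℕ N (at v)
    ≡⟨ cong₂ _∥_ (tabulateℕ-at v) (tabulateℕ-at v) ⟩
  v ∥ v
    ∎
  where
  N = 2 ^ m
  first : ∀ {j} → j < N → embedBit N v j ≡ at v j
  first j<N rewrite <ᵇ-true j<N = refl
  second : ∀ {j} → j < N → embedBit N v (N + j) ≡ at v j
  second {j} j<N rewrite <ᵇ-false (m≤m+n N j) | <ᵇ-true (+-monoʳ-< N j<N) | m+n∸m≡n N j = refl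

embed-pad : ∀ m {k} (v : Word k) → k + k ≤ 2 ^ m → embed (suc m) k v ≡ embed m k v ∥ zeroWord
embed-pad m {k} v k+k≤N =
  trans (tabulateℕ-∥ (2 ^ m) (embedBit k v))
        (cong (embed m k v ∥_) (trans (tabulateℕ-cong beyond) tabulateℕ-false))
  where
  N = 2 ^ m
  beyond : ∀ {j} → j < N → embedBit k v (N + j) ≡ false
  beyond {j} _ rewrite <ᵇ-false (≤-trans (m≤m+n k k) (≤-trans k+k≤N (m≤m+n N j)))
                     | <ᵇ-false (≤-trans k+k≤N (m≤m+n N j)) = refl

V-diagonal : ∀ m → V (suc m) 1 ≐ plotkin ｛ zeroWord {2 ^ m} ｝
V-diagonal m =
  (λ { (v , v-even , refl) →
         zeroWord , v , refl , v-even ,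
         trans (embed-half m v) (cong (_∥ v) (sym (⊕-identityˡ v))) }) ,
  (λ { (_ , v , refl , v-even , refl) →
         v , v-even , trans (cong (_∥ v) (⊕-identityˡ v)) (sym (embed-half m v)) })

V-padZero : ∀ m t → V (2 + m) (2 + t) ≐ padZero (V (1 + m) (1 + t))
V-padZero m t =
  (λ { (v , v-even , refl) →
         embed (1 + m) K v , (v , v-even , refl) , embed-pad (1 + m) v K+K≤2^[1+m] }) ,
  (λ { (_ , (v , v-even , refl) , refl) →
         v , v-even , sym (embed-pad (1 + m) v K+K≤2^[1+m]) })
  where
  K = 2 ^ (m ∸ t)
  K≤2^m : K ≤ 2 ^ m
  K≤2^m = ^-monoʳ-≤ 2 (m∸n≤m m t)
  K+K≤2^[1+m] : K + K ≤ 2 ^ (1 + m)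
  K+K≤2^[1+m] = +-mono-≤ K≤2^m (≤-trans K≤2^m (m≤m+n (2 ^ m) 0))

A′-plotkin : ∀ m k → A′ (2 + m) (1 + k) ≐ plotkin (A′ (1 + m) k)
A′-plotkin m zero =
  ≐-trans (+ˢ-resp-≐ (V-padZero m 0) (V-diagonal (1 + m)))
          (≐-trans padZero-+ˢ-plotkin (plotkin-resp-≐ +ˢ-identityʳ))
A′-plotkin m (suc k) =
  ≐-trans (+ˢ-resp-≐ (V-padZero m (suc k)) (A′-plotkin m k)) padZero-+ˢ-plotkin

≐plotkin-isLinear×isExtPerfect : C ≐ plotkin P → IsLinear P × IsExtPerfect P →
                                IsLinear C × IsExtPerfect C
≐plotkin-isLinear×isExtPerfect C≐ (linear , perfect) =
  IsLinear-resp-≐ (≐-sym C≐) (plotkin-isLinear linear) ,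
  IsExtPerfect-resp-≐ (≐-sym C≐) (plotkin-isExtPerfect perfect)

H-isLinear×isExtPerfect : ∀ j → IsLinear (H (2 + j)) × IsExtPerfect (H (2 + j))
H-isLinear×isExtPerfect zero =
  ≐plotkin-isLinear×isExtPerfect (V-diagonal 1) (｛0｝-isLinear , ｛0｝-isExtPerfect)
H-isLinear×isExtPerfect (suc j) =
  ≐plotkin-isLinear×isExtPerfect (A′-plotkin (1 + j) j) (H-isLinear×isExtPerfect j)

-- The argument needs only m ≥ 2.
proposition1 : (m : ℕ) → 4 ≤ m → IsLinear (H m) × IsExtPerfect (H m)
proposition1 (suc (suc j)) (s≤s (s≤s _)) = H-isLinear×isExtPerfect j
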